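{- Say a word $\sigma=\sigma_1\cdots\sigma_n$ over $\{1,\dots,k\}$ avoids $13\text{ - }2$ if there are no indices $i,j$ with $j>i+1$ and $\sigma_i<\sigma_j<\sigma_{i+1}$. Let $f_{13\text{ - }2}(n,k)$ be the number of such words of length $n$, and for $n\ge1$ let $a_{n,k}(i)$ be the number of such words of length $n$ with $\sigma_1=i$ (so $a_{n,k}(i)=0$ if $i>k$). Then for all $n\ge1$ and $k\ge1$, \[ f_{13\text{ - }2}(n,k)=\sum_{j=1}^k a_{n,k}(j), \] and for all $n\ge2$, $k\ge1$ and $1\le j\le k$, \[ a_{n,k}(j)=\sum_{i=1}^{j+1}a_{n-1,k}(i)+\sum_{i=j+1}^{k-1}a_{n-1,i}(j+1). \] In addition, $f_{13\text{ - }2}(n,1)=1$ for all $n\ge0$.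
   Context: Empty sums are $0$. -}

module Defs where

open import Data.Nat using (ℕ; zero; suc; _+_; _∸_; _<_; _≟_)
import Data.Nat.Properties as ℕP
open import Data.Fin using (Fin; toℕ)
open import Data.Vec using (Vec; []; _∷_; lookup; head)
open import Data.List using (List; [_]; concatMap; map; allFin; filter; length; upTo)
open import Data.Nat.ListAction using (sum)
open import Data.Product using (Σ; _×_)
open import Data.Fin.Properties using (any?)
open import Relation.Nullary using (¬_; Dec)
open import Relation.Nullary.Decidable using (¬?; _×-dec_)
open import Relation.Binary.PropositionalEquality using (_≡_)

-- A word of length n over the alphabet {1,…,k}: the letter x : Fin k stands for toℕ x + 1.
Word : ℕ → ℕ → Set
Word n k = Vec (Fin k) n

letter : ∀ {n k} → Word n k → Fin n → ℕ
letter σ p = suc (toℕ (lookup σ p))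

Contains13-2 : ∀ {n k} → Word n k → Set
Contains13-2 {n} σ =
  Σ (Fin n) λ i → Σ (Fin n) λ i' → Σ (Fin n) λ j →
    (toℕ i' ≡ suc (toℕ i)) × (toℕ i' < toℕ j) ×
    (letter σ i < letter σ j) × (letter σ j < letter σ i')

Avoids13-2 : ∀ {n k} → Word n k → Set
Avoids13-2 σ = ¬ Contains13-2 σ

contains13-2? : ∀ {n k} (σ : Word n k) → Dec (Contains13-2 σ)
contains13-2? σ = any? λ i → any? λ i' → any? λ j →
  (toℕ i' ≟ suc (toℕ i)) ×-dec (toℕ i' ℕP.<? toℕ j) ×-dec
  (letter σ i ℕP.<? letter σ j) ×-dec (letter σ j ℕP.<? letter σ i')

avoids13-2? : ∀ {n k} (σ : Word n k) → Dec (Avoids13-2 σ)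
avoids13-2? σ = ¬? (contains13-2? σ)

allWords : (n k : ℕ) → List (Word n k)
allWords zero k = [ [] ]
allWords (suc n) k = concatMap (λ x → map (x ∷_) (allWords n k)) (allFin k)

avoiders : (n k : ℕ) → List (Word n k)
avoiders n k = filter avoids13-2? (allWords n k)

f13-2 : ℕ → ℕ → ℕ
f13-2 n k = length (avoiders n k)

-- a m k i  =  a_{m+1,k}(i): number of 13-2-avoiding words of length m+1
-- over {1,…,k} whose first letter σ_1 equals i (so it is 0 when i = 0 or i > k).
a : ℕ → ℕ → ℕ → ℕ
a m k i = length (filter (λ σ → letter σ Fin.zero ≟ i) (avoiders (suc m) k))
  where import Data.Fin as Fin

-- Σ_{j=lo}^{hi} g j  (empty sum = 0 when hi < lo)
Σ[_to_] : ℕ → ℕ → (ℕ → ℕ) → ℕ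
Σ[ lo to hi ] g = sum (map (λ t → g (lo + t)) (upTo (suc hi ∸ lo)))

-- A word j i w avoids 13-2 iff i w does and no letter of w lies strictly between j and i.
-- Split the words counted by a_{n,k}(j) according to their second letter i. For i ≤ j + 1 the
-- extra condition is vacuous, which gives the terms a_{n-1,k}(i). For i = j + 1 + d, d ≥ 1, the letters
-- of w miss the d values j + 1, …, j + d; closing this gap is an order isomorphism onto an
-- alphabet of size k - d that sends i to j + 1, so it preserves avoidance and these words are
-- counted by a_{n-1,k-d}(j + 1).

module Submission where

open import Defs
open import Data.Bool using (Bool; true; false; _∧_; not; if_then_else_)
open import Data.Bool.Properties using (∧-assoc; ∧-comm; ∧-identityʳ; ∧-zeroʳ; T-≡)
open import Data.Fin using (Fin; toℕ) renaming (zero to fzero; suc to fsuc)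
open import Data.List using (List; []; _∷_; _++_; map; filter; length; concatMap; tabulate; allFin; applyUpTo)
open import Data.List.Properties using (map-tabulate; map-upTo)
open import Data.Nat using (ℕ; zero; suc; _+_; _∸_; _≤_; _<_; z≤n; s≤s; _<ᵇ_; _≡ᵇ_; _≤?_; _<?_; _≟_)
open import Data.Nat.ListAction using (sum)
open import Data.Nat.Properties
open import Data.Product using (Σ; _×_; _,_)
open import Data.Sum using (_⊎_; inj₁; inj₂; [_,_]′)
open import Data.Vec using (Vec; []; _∷_; lookup; replicate)
import Data.Vec as Vec
open import Function.Bundles using (Equivalence; mk⇔)
open import Level using (Level)
open import Relation.Binary.PropositionalEquality
open import Relation.Nullary using (does; yes; no; _×-dec_; contradiction)
open import Relation.Nullary.Decidable using (dec-true; dec-false; does-⇔)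
open import Relation.Unary using (Pred; Decidable)

sumTo : ℕ → (ℕ → ℕ) → ℕ
sumTo n g = sum (applyUpTo g n)

Σ[to]≡sumTo : ∀ lo hi g → Σ[ lo to hi ] g ≡ sumTo (suc hi ∸ lo) (λ t → g (lo + t))
Σ[to]≡sumTo lo hi g = cong sum (map-upTo (λ t → g (lo + t)) (suc hi ∸ lo))

sumTo-cong : ∀ n {g h : ℕ → ℕ} → (∀ t → t < n → g t ≡ h t) → sumTo n g ≡ sumTo n h
sumTo-cong zero    g≡h = refl
sumTo-cong (suc n) g≡h = cong₂ _+_ (g≡h 0 (s≤s z≤n)) (sumTo-cong n (λ t t<n → g≡h (suc t) (s≤s t<n)))

sumTo-zeros : ∀ n → sumTo n (λ _ → 0) ≡ 0
sumTo-zeros zero    = refl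
sumTo-zeros (suc n) = sumTo-zeros n

sumTo-+ : ∀ m n g → sumTo (m + n) g ≡ sumTo m g + sumTo n (λ t → g (m + t))
sumTo-+ zero    n g = refl
sumTo-+ (suc m) n g = trans (cong (g 0 +_) (sumTo-+ m n (λ t → g (suc t)))) (sym (+-assoc (g 0) _ _))

sumTo-suc : ∀ n g → sumTo (suc n) g ≡ sumTo n g + g n
sumTo-suc zero    g = +-comm (g 0) 0
sumTo-suc (suc n) g = trans (cong (g 0 +_) (sumTo-suc n (λ t → g (suc t)))) (sym (+-assoc (g 0) _ _))

sumTo-reverse : ∀ n g → sumTo n g ≡ sumTo n (λ t → g (n ∸ suc t))
sumTo-reverse zero    g = refl
sumTo-reverse (suc n) g = begin
  g 0 + sumTo n (λ t → g (suc t))                  ≡⟨ cong (g 0 +_) (sumTo-reverse n (λ t → g (suc t))) ⟩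
  g 0 + sumTo n (λ t → g (suc (n ∸ suc t)))        ≡⟨ +-comm (g 0) _ ⟩
  sumTo n (λ t → g (suc (n ∸ suc t))) + g 0
    ≡⟨ cong₂ _+_ (sumTo-cong n (λ t t<n → cong g (sym (+-∸-assoc 1 t<n)))) (cong g (sym (n∸n≡0 n))) ⟩
  sumTo n (λ t → g (suc n ∸ suc t)) + g (n ∸ n)    ≡⟨ sym (sumTo-suc n (λ t → g (suc n ∸ suc t))) ⟩
  sumTo (suc n) (λ t → g (suc n ∸ suc t))          ∎
  where open ≡-Reasoning

sumTo-indicator : ∀ k y g → sumTo k (λ t → if t ≡ᵇ y then g t else 0) ≡ (if y <ᵇ k then g y else 0)
sumTo-indicator zero    y       g = refl
sumTo-indicator (suc k) zero    g = trans (cong (g 0 +_) (sumTo-zeros k)) (+-identityʳ (g 0))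
sumTo-indicator (suc k) (suc y) g = sumTo-indicator k y (λ t → g (suc t))

-- Letters are 0, …, k - 1 from here on, one less than in the paper.
count : (n k : ℕ) → (Vec ℕ n → Bool) → ℕ
count zero    k P = if P [] then 1 else 0
count (suc n) k P = sumTo k (λ t → count n k (λ w → P (t ∷ w)))

count-cong : ∀ n k {P Q : Vec ℕ n → Bool} → (∀ w → P w ≡ Q w) → count n k P ≡ count n k Q
count-cong zero    k P≡Q = cong (λ b → if b then 1 else 0) (P≡Q [])
count-cong (suc n) k P≡Q = sumTo-cong k (λ t _ → count-cong n k (λ w → P≡Q (t ∷ w)))

count-false : ∀ n k → count n k (λ _ → false) ≡ 0
count-false zero    k = refl
count-false (suc n) k = trans (sumTo-cong k (λ t _ → count-false n k)) (sumTo-zeros k)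

count-const-∧ : ∀ n k b (P : Vec ℕ n → Bool) → count n k (λ w → b ∧ P w) ≡ (if b then count n k P else 0)
count-const-∧ n k true  P = refl
count-const-∧ n k false P = count-false n k

count-unary : ∀ n (P : Vec ℕ n → Bool) → count n 1 P ≡ (if P (replicate n 0) then 1 else 0)
count-unary zero    P = refl
count-unary (suc n) P = trans (+-identityʳ _) (count-unary n (λ w → P (0 ∷ w)))

module _ {a p : Level} {A : Set a} {P : Pred A p} (P? : Decidable P) where

  length-filter-++ : ∀ xs ys → length (filter P? (xs ++ ys)) ≡ length (filter P? xs) + length (filter P? ys)
  length-filter-++ []       ys = refl
  length-filter-++ (x ∷ xs) ys with does (P? x)
  ... | true  = cong suc (length-filter-++ xs ys)
  ... | false = length-filter-++ xs ys

  length-filter-concatMap : ∀ {b} {B : Set b} (f : B → List A) xs →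
    length (filter P? (concatMap f xs)) ≡ sum (map (λ x → length (filter P? (f x))) xs)
  length-filter-concatMap f []       = refl
  length-filter-concatMap f (x ∷ xs) =
    trans (length-filter-++ (f x) (concatMap f xs)) (cong (length (filter P? (f x)) +_) (length-filter-concatMap f xs))

  length-filter-map : ∀ {b} {B : Set b} (f : B → A) xs →
    length (filter P? (map f xs)) ≡ length (filter (λ x → P? (f x)) xs)
  length-filter-map f []       = refl
  length-filter-map f (x ∷ xs) with does (P? (f x))
  ... | true  = cong suc (length-filter-map f xs)
  ... | false = length-filter-map f xs

  length-filter-filter : ∀ {q} {Q : Pred A q} (Q? : Decidable Q) xs →
    length (filter Q? (filter P? xs)) ≡ length (filter (λ x → P? x ×-dec Q? x) xs)
  length-filter-filter Q? []       = refl
  length-filter-filter Q? (x ∷ xs) with does (P? x)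
  ... | false = length-filter-filter Q? xs
  ... | true with does (Q? x)
  ...   | true  = cong suc (length-filter-filter Q? xs)
  ...   | false = length-filter-filter Q? xs

sum-tabulate : ∀ k {f : Fin k → ℕ} {g : ℕ → ℕ} → (∀ i → f i ≡ g (toℕ i)) →
               sum (tabulate f) ≡ sumTo k g
sum-tabulate zero    f≡g = refl
sum-tabulate (suc k) f≡g = cong₂ _+_ (f≡g fzero) (sum-tabulate k (λ i → f≡g (fsuc i)))

toℕs : ∀ {n k} → Word n k → Vec ℕ n
toℕs = Vec.map toℕ

length-filter-allWords : ∀ n k {p} {P : Pred (Word n k) p} (P? : Decidable P) (Pᵇ : Vec ℕ n → Bool) →
  (∀ σ → does (P? σ) ≡ Pᵇ (toℕs σ)) → length (filter P? (allWords n k)) ≡ count n k Pᵇ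
length-filter-allWords zero    k P? Pᵇ P?≡Pᵇ rewrite sym (P?≡Pᵇ []) with does (P? [])
... | true  = refl
... | false = refl
length-filter-allWords (suc n) k P? Pᵇ P?≡Pᵇ = begin
  length (filter P? (concatMap extensions (allFin k)))  ≡⟨ length-filter-concatMap P? extensions (allFin k) ⟩
  sum (map count-extensions (allFin k))                  ≡⟨ cong sum (map-tabulate (λ x → x) count-extensions) ⟩
  sum (tabulate count-extensions)                        ≡⟨ sum-tabulate k count-extensions≡count ⟩
  count (suc n) k Pᵇ                                     ∎
  where
  open ≡-Reasoning
  extensions : Fin k → List (Word (suc n) k)
  extensions x = map (x ∷_) (allWords n k)
  count-extensions : Fin k → ℕ
  count-extensions x = length (filter P? (extensions x))
  count-extensions≡count : ∀ x → count-extensions x ≡ count n k (λ w → Pᵇ (toℕ x ∷ w))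
  count-extensions≡count x = trans (length-filter-map P? (x ∷_) (allWords n k))
    (length-filter-allWords n k (λ σ → P? (x ∷ σ)) (λ w → Pᵇ (toℕ x ∷ w)) (λ σ → P?≡Pᵇ (x ∷ σ)))

<ᵇ-true : ∀ {m n} → m < n → (m <ᵇ n) ≡ true
<ᵇ-true {m} {n} = dec-true (m <? n)

<ᵇ-false : ∀ {m n} → n ≤ m → (m <ᵇ n) ≡ false
<ᵇ-false {m} {n} n≤m = dec-false (m <? n) (≤⇒≯ n≤m)

<ᵇ-true⇒< : ∀ {m n} → (m <ᵇ n) ≡ true → m < n
<ᵇ-true⇒< {m} {n} eq = <ᵇ⇒< m n (Equivalence.from T-≡ eq)

∧≡false : ∀ a {b} → a ∧ b ≡ false → a ≡ false ⊎ b ≡ false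
∧≡false false _  = inj₁ refl
∧≡false true  eq = inj₂ eq

between : ℕ → ℕ → ℕ → Bool
between x y z = (x <ᵇ z) ∧ (z <ᵇ y)

noneBetween : ∀ {n} → ℕ → ℕ → Vec ℕ n → Bool
noneBetween x y []      = true
noneBetween x y (z ∷ w) = not (between x y z) ∧ noneBetween x y w

avoids : ∀ {n} → Vec ℕ n → Bool
avoids []          = true
avoids (x ∷ [])    = true
avoids (x ∷ y ∷ w) = avoids (y ∷ w) ∧ noneBetween x y w

noneBetween-false : ∀ {n k} x y (w : Word n k) (j : Fin n) →
  x < toℕ (lookup w j) → toℕ (lookup w j) < y → noneBetween x y (toℕs w) ≡ false
noneBetween-false x y (z ∷ w) fzero    x<z z<y rewrite <ᵇ-true x<z | <ᵇ-true z<y = refl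
noneBetween-false x y (z ∷ w) (fsuc j) x<z z<y rewrite noneBetween-false x y w j x<z z<y = ∧-zeroʳ _

noneBetween-false⇒witness : ∀ {n k} x y (w : Word n k) → noneBetween x y (toℕs w) ≡ false →
  Σ (Fin n) λ j → x < toℕ (lookup w j) × toℕ (lookup w j) < y
noneBetween-false⇒witness x y (z ∷ w) eq with x <ᵇ toℕ z in x<z | toℕ z <ᵇ y in z<y
... | true  | true  = fzero , <ᵇ-true⇒< x<z , <ᵇ-true⇒< z<y
... | true  | false = let j , p = noneBetween-false⇒witness x y w eq in fsuc j , p
... | false | _     = let j , p = noneBetween-false⇒witness x y w eq in fsuc j , p

contains⇒avoids-false : ∀ {n k} (σ : Word n k) → Contains13-2 σ → avoids (toℕs σ) ≡ false
contains⇒avoids-false (x ∷ y ∷ w) (fzero , fsuc fzero , fsuc (fsuc j) , refl , _ , s≤s x<z , s≤s z<y)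
  rewrite noneBetween-false (toℕ x) (toℕ y) w j x<z z<y = ∧-zeroʳ _
contains⇒avoids-false (x ∷ y ∷ w) (fsuc i , fsuc i' , fsuc j , i'≡1+i , s≤s i'<j , σi<σj<σi')
  rewrite contains⇒avoids-false (y ∷ w) (i , i' , j , suc-injective i'≡1+i , i'<j , σi<σj<σi') = refl
contains⇒avoids-false (x ∷ [])    (fzero , fzero , _ , () , _)
contains⇒avoids-false (x ∷ y ∷ w) (fzero , fzero , _ , () , _)
contains⇒avoids-false (x ∷ y ∷ w) (fzero , fsuc (fsuc _) , _ , () , _)
contains⇒avoids-false (x ∷ y ∷ w) (fzero , fsuc fzero , fzero , _ , () , _)
contains⇒avoids-false (x ∷ y ∷ w) (fzero , fsuc fzero , fsuc fzero , _ , s≤s () , _)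
contains⇒avoids-false (x ∷ y ∷ w) (fsuc _ , fzero , _ , () , _)
contains⇒avoids-false (x ∷ y ∷ w) (fsuc _ , fsuc _ , fzero , _ , () , _)

contains-∷ : ∀ {n k} (x : Fin k) (σ : Word n k) → Contains13-2 σ → Contains13-2 (x ∷ σ)
contains-∷ x σ (i , i' , j , i'≡1+i , i'<j , σi<σj<σi') =
  fsuc i , fsuc i' , fsuc j , cong suc i'≡1+i , s≤s i'<j , σi<σj<σi'

avoids-false⇒contains : ∀ {n k} (σ : Word n k) → avoids (toℕs σ) ≡ false → Contains13-2 σ
avoids-false⇒contains (x ∷ y ∷ w) eq =
  [ (λ tail-false → contains-∷ x (y ∷ w) (avoids-false⇒contains (y ∷ w) tail-false))
  , (λ none-false → head-pattern (noneBetween-false⇒witness (toℕ x) (toℕ y) w none-false))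
  ]′ (∧≡false (avoids (toℕs (y ∷ w))) eq)
  where
  head-pattern : (Σ _ λ j → toℕ x < toℕ (lookup w j) × toℕ (lookup w j) < toℕ y) →
                 Contains13-2 (x ∷ y ∷ w)
  head-pattern (j , x<z , z<y) = fzero , fsuc fzero , fsuc (fsuc j) , refl , s≤s (s≤s z≤n) , s≤s x<z , s≤s z<y

does-avoids13-2? : ∀ {n k} (σ : Word n k) → does (avoids13-2? σ) ≡ avoids (toℕs σ)
does-avoids13-2? σ with avoids (toℕs σ) in eq
... | true  = dec-true (avoids13-2? σ) (λ c → contradiction (trans (sym eq) (contains⇒avoids-false σ c)) λ ())
... | false = dec-false (avoids13-2? σ) (λ ¬c → ¬c (avoids-false⇒contains σ eq))

f13-2≡count : ∀ n k → f13-2 n k ≡ count n k avoids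
f13-2≡count n k = length-filter-allWords n k avoids13-2? avoids does-avoids13-2?

-- This is a_{m+1,k}(y + 1) only for y < k: the first letter y is not required to be a letter.
startingWith : ℕ → ℕ → ℕ → ℕ
startingWith m k y = count m k (λ w → avoids (y ∷ w))

a≡startingWith : ∀ m k y → a m k (suc y) ≡ (if y <ᵇ k then startingWith m k y else 0)
a≡startingWith m k y = begin
  a m k (suc y)
    ≡⟨ length-filter-filter avoids13-2? (λ σ → letter σ fzero ≟ suc y) (allWords (suc m) k) ⟩
  length (filter (λ σ → avoids13-2? σ ×-dec (letter σ fzero ≟ suc y)) (allWords (suc m) k))
    ≡⟨ length-filter-allWords (suc m) k _ (λ w → avoids w ∧ (Vec.head w ≡ᵇ y)) does-avoids-starting ⟩
  sumTo k (λ t → count m k (λ w → avoids (t ∷ w) ∧ (t ≡ᵇ y)))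
    ≡⟨ sumTo-cong k (λ t _ → trans (count-cong m k (λ w → ∧-comm (avoids (t ∷ w)) (t ≡ᵇ y)))
                                   (count-const-∧ m k (t ≡ᵇ y) _)) ⟩
  sumTo k (λ t → if t ≡ᵇ y then startingWith m k t else 0)
    ≡⟨ sumTo-indicator k y (startingWith m k) ⟩
  (if y <ᵇ k then startingWith m k y else 0) ∎
  where
  open ≡-Reasoning
  does-avoids-starting : ∀ (σ : Word (suc m) k) →
    does (avoids13-2? σ ×-dec (letter σ fzero ≟ suc y)) ≡ avoids (toℕs σ) ∧ (Vec.head (toℕs σ) ≡ᵇ y)
  does-avoids-starting σ@(_ ∷ _) = cong (_∧ _) (does-avoids13-2? σ)

noneBetween-adjacent : ∀ {n} x y (w : Vec ℕ n) → y ≤ suc x → noneBetween x y w ≡ true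
noneBetween-adjacent x y []      y≤1+x = refl
noneBetween-adjacent x y (z ∷ w) y≤1+x with x <? z
... | no  x≮z rewrite <ᵇ-false (≮⇒≥ x≮z) = noneBetween-adjacent x y w y≤1+x
... | yes x<z rewrite <ᵇ-true x<z | <ᵇ-false (≤-trans y≤1+x x<z) = noneBetween-adjacent x y w y≤1+x

module Gap (x d : ℕ) where

  shift : ℕ → ℕ
  shift t with t ≤? x
  ... | yes _ = t
  ... | no  _ = t + d

  shift-low : ∀ {t} → t ≤ x → shift t ≡ t
  shift-low {t} t≤x with t ≤? x
  ... | yes _   = refl
  ... | no  t≰x = contradiction t≤x t≰x

  shift-high : ∀ {t} → x < t → shift t ≡ t + d
  shift-high {t} x<t with t ≤? x
  ... | yes t≤x = contradiction t≤x (<⇒≱ x<t)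
  ... | no  _   = refl

  shift-mono-< : ∀ {a b} → a < b → shift a < shift b
  shift-mono-< {a} {b} a<b with a ≤? x | b ≤? x
  ... | yes _   | yes _   = a<b
  ... | yes _   | no  _   = ≤-trans a<b (m≤m+n b d)
  ... | no  a≰x | yes b≤x = contradiction (≤-trans (<⇒≤ a<b) b≤x) a≰x
  ... | no  _   | no  _   = +-monoˡ-< d a<b

  shift-reflects-< : ∀ {a b} → shift a < shift b → a < b
  shift-reflects-< {a} {b} sa<sb with a ≤? x | b ≤? x
  ... | yes _   | yes _   = sa<sb
  ... | yes a≤x | no  b≰x = ≤-<-trans a≤x (≰⇒> b≰x)
  ... | no  a≰x | yes b≤x =
    contradiction (≤-trans (≤-trans (≰⇒> a≰x) (m≤m+n a d)) (<⇒≤ sa<sb)) (<⇒≱ (s≤s b≤x))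
  ... | no  _   | no  _   = +-cancelʳ-< d a b sa<sb

  <ᵇ-shift : ∀ a b → (shift a <ᵇ shift b) ≡ (a <ᵇ b)
  <ᵇ-shift a b = does-⇔ (mk⇔ shift-reflects-< shift-mono-<) (shift a <? shift b) (a <? b)

  avoids-shift : ∀ {n} (w : Vec ℕ n) → avoids (Vec.map shift w) ≡ avoids w
  avoids-shift []          = refl
  avoids-shift (a ∷ [])    = refl
  avoids-shift (a ∷ b ∷ w) = cong₂ _∧_ (avoids-shift (b ∷ w)) (noneBetween-shift w)
    where
    noneBetween-shift : ∀ {n} (w : Vec ℕ n) → noneBetween (shift a) (shift b) (Vec.map shift w) ≡ noneBetween a b w
    noneBetween-shift []      = refl
    noneBetween-shift (z ∷ w) =
      cong₂ _∧_ (cong not (cong₂ _∧_ (<ᵇ-shift a z) (<ᵇ-shift z b))) (noneBetween-shift w)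

  gapFree : ∀ {n} → Vec ℕ n → Bool
  gapFree = noneBetween x (suc x + d)

  zeroOnGap : (ℕ → ℕ) → ℕ → ℕ
  zeroOnGap h t = if not (between x (suc x + d) t) then h t else 0

  sumTo-zeroOnGap : ∀ p h → sumTo (suc x + p + d) (zeroOnGap h) ≡ sumTo (suc x + p) (λ t → h (shift t))
  sumTo-zeroOnGap p h = begin
    sumTo (suc x + p + d) (zeroOnGap h)
      ≡⟨ cong (λ K → sumTo K (zeroOnGap h)) (trans (+-assoc (suc x) p d) (cong (suc x +_) (+-comm p d))) ⟩
    sumTo (suc x + (d + p)) (zeroOnGap h)
      ≡⟨ trans (sumTo-+ (suc x) (d + p) (zeroOnGap h)) (cong (sumTo (suc x) (zeroOnGap h) +_) (sumTo-+ d p _)) ⟩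
    sumTo (suc x) (zeroOnGap h)
      + (sumTo d (λ t → zeroOnGap h (suc x + t)) + sumTo p (λ t → zeroOnGap h (suc x + (d + t))))
      ≡⟨ cong₂ _+_ (sumTo-cong (suc x) below)
                   (cong₂ _+_ (trans (sumTo-cong d inside) (sumTo-zeros d)) (sumTo-cong p above)) ⟩
    sumTo (suc x) (λ t → h (shift t)) + sumTo p (λ t → h (shift (suc x + t)))
      ≡⟨ sym (sumTo-+ (suc x) p (λ t → h (shift t))) ⟩
    sumTo (suc x + p) (λ t → h (shift t)) ∎
    where
    open ≡-Reasoning
    below : ∀ t → t < suc x → zeroOnGap h t ≡ h (shift t)
    below t (s≤s t≤x) rewrite <ᵇ-false t≤x | shift-low t≤x = refl
    inside : ∀ t → t < d → zeroOnGap h (suc x + t) ≡ 0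
    inside t t<d rewrite <ᵇ-true (s≤s (m≤m+n x t)) | <ᵇ-true (+-monoʳ-< (suc x) t<d) = refl
    above : ∀ t → t < p → zeroOnGap h (suc x + (d + t)) ≡ h (shift (suc x + t))
    above t _ rewrite <ᵇ-true (s≤s (m≤m+n x (d + t))) | <ᵇ-false (+-monoʳ-≤ (suc x) (m≤m+n d t))
                    | shift-high (s≤s (m≤m+n x t)) =
      cong h (trans (cong (suc x +_) (+-comm d t)) (sym (+-assoc (suc x) t d)))

  count-gapFree : ∀ n p (R : Vec ℕ n → Bool) →
    count n (suc x + p + d) (λ w → gapFree w ∧ R w) ≡ count n (suc x + p) (λ w → R (Vec.map shift w))
  count-gapFree zero    p R = refl
  count-gapFree (suc n) p R =
    trans (sumTo-cong (suc x + p + d) (λ t _ → first-letter t)) (sumTo-zeroOnGap p h)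
    where
    h : ℕ → ℕ
    h t = count n (suc x + p) (λ w → R (t ∷ Vec.map shift w))
    first-letter : ∀ t → count n (suc x + p + d) (λ w → gapFree (t ∷ w) ∧ R (t ∷ w)) ≡ zeroOnGap h t
    first-letter t = begin
      count n (suc x + p + d) (λ w → (outside ∧ gapFree w) ∧ R (t ∷ w))
        ≡⟨ count-cong n (suc x + p + d) (λ w → ∧-assoc outside _ _) ⟩
      count n (suc x + p + d) (λ w → outside ∧ (gapFree w ∧ R (t ∷ w)))
        ≡⟨ count-const-∧ n (suc x + p + d) outside _ ⟩
      (if outside then count n (suc x + p + d) (λ w → gapFree w ∧ R (t ∷ w)) else 0)
        ≡⟨ cong (λ c → if outside then c else 0) (count-gapFree n p (λ w → R (t ∷ w))) ⟩
      zeroOnGap h t ∎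
      where
      open ≡-Reasoning
      outside = not (between x (suc x + d) t)

  startingWith-above-gap : ∀ m p →
    count m (suc x + p + d) (λ w → avoids (suc x + d ∷ w) ∧ gapFree w) ≡ startingWith m (suc x + p) (suc x)
  startingWith-above-gap m p = begin
    count m (suc x + p + d) (λ w → avoids (suc x + d ∷ w) ∧ gapFree w)
      ≡⟨ count-cong m (suc x + p + d) (λ w → ∧-comm (avoids (suc x + d ∷ w)) _) ⟩
    count m (suc x + p + d) (λ w → gapFree w ∧ avoids (suc x + d ∷ w))
      ≡⟨ count-gapFree m p (λ w → avoids (suc x + d ∷ w)) ⟩
    count m (suc x + p) (λ w → avoids (suc x + d ∷ Vec.map shift w))
      ≡⟨ count-cong m (suc x + p) (λ w → trans (cong (λ y → avoids (y ∷ Vec.map shift w)) (sym (shift-high (n<1+n x))))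
                                               (avoids-shift (suc x ∷ w))) ⟩
    startingWith m (suc x + p) (suc x) ∎
    where open ≡-Reasoning

startingWith-suc : ∀ m x q →
  startingWith (suc m) (suc x + q) x
    ≡ sumTo (suc x) (startingWith m (suc x + q)) + sumTo q (λ t → startingWith m (suc (suc x) + t) (suc x))
startingWith-suc m x q = begin
  sumTo k withSecond
    ≡⟨ sumTo-+ (suc x) q withSecond ⟩
  sumTo (suc x) withSecond + sumTo q (λ t → withSecond (suc x + t))
    ≡⟨ cong₂ _+_ (sumTo-cong (suc x) withSecond-adjacent) (sumTo-cong q withSecond-above) ⟩
  sumTo (suc x) (startingWith m k) + sumTo q (λ t → startingWith m (suc x + (q ∸ t)) (suc x))
    ≡⟨ cong (sumTo (suc x) (startingWith m k) +_) (trans (sumTo-reverse q _) (sumTo-cong q reversed-index)) ⟩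
  sumTo (suc x) (startingWith m k) + sumTo q (λ t → startingWith m (suc (suc x) + t) (suc x)) ∎
  where
  open ≡-Reasoning
  k = suc x + q
  withSecond : ℕ → ℕ
  withSecond y = count m k (λ w → avoids (y ∷ w) ∧ noneBetween x y w)
  withSecond-adjacent : ∀ y → y < suc x → withSecond y ≡ startingWith m k y
  withSecond-adjacent y (s≤s y≤x) = count-cong m k λ w →
    trans (cong (avoids (y ∷ w) ∧_) (noneBetween-adjacent x y w (m≤n⇒m≤1+n y≤x))) (∧-identityʳ _)
  withSecond-above : ∀ t → t < q → withSecond (suc x + t) ≡ startingWith m (suc x + (q ∸ t)) (suc x)
  withSecond-above t t<q =
    trans (cong (λ K → count m K (λ w → avoids (suc x + t ∷ w) ∧ noneBetween x (suc x + t) w)) k≡)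
          (Gap.startingWith-above-gap x t m (q ∸ t))
    where
    k≡ : k ≡ suc x + (q ∸ t) + t
    k≡ = sym (trans (+-assoc (suc x) (q ∸ t) t) (cong (suc x +_) (m∸n+n≡m (<⇒≤ t<q))))
  reversed-index : ∀ t → t < q →
    startingWith m (suc x + (q ∸ (q ∸ suc t))) (suc x) ≡ startingWith m (suc (suc x) + t) (suc x)
  reversed-index t t<q =
    cong (λ K → startingWith m K (suc x)) (trans (cong (suc x +_) (m∸[m∸n]≡n t<q)) (+-suc (suc x) t))

a-in-alphabet : ∀ m {k y} → y < k → a m k (suc y) ≡ startingWith m k y
a-in-alphabet m {k} {y} y<k =
  trans (a≡startingWith m k y) (cong (λ b → if b then startingWith m k y else 0) (<ᵇ-true y<k))

a-outside-alphabet : ∀ m {k y} → k ≤ y → a m k (suc y) ≡ 0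
a-outside-alphabet m {k} {y} k≤y =
  trans (a≡startingWith m k y) (cong (λ b → if b then startingWith m k y else 0) (<ᵇ-false k≤y))

avoids-replicate : ∀ n c → avoids (replicate n c) ≡ true
avoids-replicate zero          c = refl
avoids-replicate (suc zero)    c = refl
avoids-replicate (suc (suc n)) c rewrite avoids-replicate (suc n) c = noneBetween-adjacent c c (replicate n c) (n≤1+n c)

f13-2-by-first-letter : ∀ n k → f13-2 (suc n) k ≡ Σ[ 1 to k ] (λ j → a n k j)
f13-2-by-first-letter n k = begin
  f13-2 (suc n) k                     ≡⟨ f13-2≡count (suc n) k ⟩
  sumTo k (startingWith n k)          ≡⟨ sumTo-cong k (λ t t<k → sym (a-in-alphabet n t<k)) ⟩
  sumTo k (λ t → a n k (suc t))       ≡⟨ sym (Σ[to]≡sumTo 1 k (a n k)) ⟩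
  Σ[ 1 to k ] (λ j → a n k j)         ∎
  where open ≡-Reasoning

a-recurrence-sumTo : ∀ n x q →
  a (suc n) (suc x + q) (suc x)
    ≡ sumTo (suc (suc x)) (λ t → a n (suc x + q) (suc t)) + sumTo (q ∸ 1) (λ t → a n (suc (suc x) + t) (suc (suc x)))
a-recurrence-sumTo n x q = begin
  a (suc n) k (suc x)
    ≡⟨ a-in-alphabet (suc n) (m≤m+n (suc x) q) ⟩
  startingWith (suc n) k x
    ≡⟨ startingWith-suc n x q ⟩
  sumTo (suc x) (startingWith n k) + sumTo q (λ t → startingWith n (suc (suc x) + t) (suc x))
    ≡⟨ cong₂ _+_ (sumTo-cong (suc x) (λ t t<1+x → sym (a-in-alphabet n (≤-trans t<1+x (m≤m+n (suc x) q)))))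
                 (sumTo-cong q (λ t _ → sym (a-in-alphabet n (m≤m+n (suc (suc x)) t)))) ⟩
  sumTo (suc x) (λ t → a n k (suc t)) + sumTo q later
    ≡⟨ cong (sumTo (suc x) (λ t → a n k (suc t)) +_) (sym (move-last q)) ⟩
  sumTo (suc x) (λ t → a n k (suc t)) + (a n k (suc (suc x)) + sumTo (q ∸ 1) later)
    ≡⟨ sym (+-assoc (sumTo (suc x) (λ t → a n k (suc t))) _ _) ⟩
  sumTo (suc x) (λ t → a n k (suc t)) + a n k (suc (suc x)) + sumTo (q ∸ 1) later
    ≡⟨ cong (_+ sumTo (q ∸ 1) later) (sym (sumTo-suc (suc x) (λ t → a n k (suc t)))) ⟩
  sumTo (suc (suc x)) (λ t → a n k (suc t)) + sumTo (q ∸ 1) later ∎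
  where
  open ≡-Reasoning
  k = suc x + q
  later : ℕ → ℕ
  later t = a n (suc (suc x) + t) (suc (suc x))
  -- the summand i = j + 1 of the paper's first sum is the summand i = k of the second sum here;
  -- it vanishes when k = j
  move-last : ∀ q → a n (suc x + q) (suc (suc x)) + sumTo (q ∸ 1) later ≡ sumTo q later
  move-last zero    = trans (+-identityʳ _) (a-outside-alphabet n (≤-reflexive (+-identityʳ (suc x))))
  move-last (suc q) = begin
    a n (suc x + suc q) (suc (suc x)) + sumTo q later   ≡⟨ +-comm _ (sumTo q later) ⟩
    sumTo q later + a n (suc x + suc q) (suc (suc x))
      ≡⟨ cong (λ K → sumTo q later + a n K (suc (suc x))) (+-suc (suc x) q) ⟩
    sumTo q later + later q                             ≡⟨ sym (sumTo-suc q later) ⟩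
    sumTo (suc q) later                                 ∎

a-recurrence : ∀ n k j → 1 ≤ j → j ≤ k →
  a (suc n) k j ≡ Σ[ 1 to j + 1 ] (λ i → a n k i) + Σ[ j + 1 to k ∸ 1 ] (λ i → a n i (j + 1))
a-recurrence n k (suc x) _ j≤k with m≤n⇒∃[o]m+o≡n j≤k
... | q , refl rewrite +-comm x 1 = begin
  a (suc n) (suc x + q) (suc x)
    ≡⟨ a-recurrence-sumTo n x q ⟩
  sumTo (suc (suc x)) (λ t → a n (suc x + q) (suc t)) + sumTo (q ∸ 1) (λ t → a n (suc (suc x) + t) (suc (suc x)))
    ≡⟨ sym (cong₂ _+_ (Σ[to]≡sumTo 1 (suc (suc x)) (a n (suc x + q))) later-sum) ⟩
  Σ[ 1 to suc (suc x) ] (λ i → a n (suc x + q) i) + Σ[ suc (suc x) to x + q ] (λ i → a n i (suc (suc x))) ∎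
  where
  open ≡-Reasoning
  later-sum : Σ[ suc (suc x) to x + q ] (λ i → a n i (suc (suc x)))
            ≡ sumTo (q ∸ 1) (λ t → a n (suc (suc x) + t) (suc (suc x)))
  later-sum = trans (Σ[to]≡sumTo (suc (suc x)) (x + q) (λ i → a n i (suc (suc x))))
                    (cong (λ L → sumTo L (λ t → a n (suc (suc x) + t) (suc (suc x))))
                          (trans (cong (x + q ∸_) (+-comm 1 x)) ([m+n]∸[m+o]≡n∸o x q 1)))

f13-2-unary : ∀ n → f13-2 n 1 ≡ 1
f13-2-unary n rewrite f13-2≡count n 1 | count-unary n avoids | avoids-replicate n 0 = refl

lemma3p7 :
    ((n k : ℕ) → 1 ≤ k → f13-2 (suc n) k ≡ Σ[ 1 to k ] (λ j → a n k j))
    × ((n k j : ℕ) → 1 ≤ k → 1 ≤ j → j ≤ k →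
        a (suc n) k j
          ≡ Σ[ 1 to j + 1 ] (λ i → a n k i) + Σ[ j + 1 to k ∸ 1 ] (λ i → a n i (j + 1)))
    × ((n : ℕ) → f13-2 n 1 ≡ 1)
lemma3p7 = (λ n k _ → f13-2-by-first-letter n k) , (λ n k j _ → a-recurrence n k j) , f13-2-unary
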